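{- For all formulas $A,B$: if $A\vDash_{\mathbf{CNL_4^2}}B$, then $A\vdash B$ is provable in $\mathbf{CNL_4^2}$.
   Context: Formulas are built from a countable set $PV$ of variables with binary $\wedge,\vee$ and unary ${\sim}$; ${\sim}^{n}A$ denotes $n$-fold application of ${\sim}$. Semantics: $\mathscr U=\{\mathbf T,\mathbf{TU},\mathbf{FU},\mathbf F\}$ ordered as the lattice $4\mathcal Q$ with $\mathbf T$ top, $\mathbf F$ bottom, $\mathbf{TU},\mathbf{FU}$ incomparable; $f_{\sim}$: $\mathbf T\mapsto\mathbf{TU}$, $\mathbf{TU}\mapsto\mathbf F$, $\mathbf F\mapsto\mathbf{FU}$, $\mathbf{FU}\mapsto\mathbf T$; designated set $\mathcal D=\{\mathbf T,\mathbf{TU}\}$. A $\mathbf{CNL_4^2}$-valuation is a map $PV\to\mathscr U$ extended to formulas with $\wedge,\vee$ as meet/join in $4\mathcal Q$ and ${\sim}$ as $f_{\sim}$. $A\vDash_{\mathbf{CNL_4^2}}B$ means every $\mathbf{CNL_4^2}$-valuation $v$ with $v(A)\in\mathcal D$ has $v(B)\in\mathcal D$. The calculus $\mathbf{CNL_4^2}$ (on sequents $A\vdash B$) has axiom schemata (a1) $A\wedge B\vdash A$; (a2) $A\wedge B\vdash B$; (a3) $B\vdash A\vee B$; (a4) $A\vdash A\vee B$; (a5) $A\vdash{\sim}^{4}A$; (a6) ${\sim}^{4}A\vdash A$; (a7) ${\sim}A\wedge{\sim}B\vdash{\sim}(A\wedge B)$; (a8) ${\sim}(A\vee B)\vdash{\sim}A\vee{\sim}B$;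 (a9) $A\wedge{\sim}^{2}A\vdash B$; (a10) $A\wedge(B\vee C)\vdash(A\wedge B)\vee(A\wedge C)$; (b1) ${\sim}(A\wedge B)\vdash{\sim}A\wedge{\sim}B$; (b2) ${\sim}A\vee{\sim}B\vdash{\sim}(A\vee B)$; and rules (r1) $A\vdash B$, $B\vdash C$ / $A\vdash C$; (r2) $A\vdash B$, $A\vdash C$ / $A\vdash B\wedge C$; (r3) $A\vdash C$, $B\vdash C$ / $A\vee B\vdash C$; (r4) $A\vdash B$ / ${\sim}^{2}B\vdash{\sim}^{2}A$. A proof is a finite list of sequents each an axiom or obtained from earlier ones by a rule; $A\vdash B$ is provable if it is the last item of some proof. -}

module Defs where

open import Data.Nat using (ℕ; zero; suc)

PV : Set
PV = ℕ

infixr 6 _∧_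
infixr 5 _∨_
data Formula : Set where
  var : PV → Formula
  _∧_ : Formula → Formula → Formula
  _∨_ : Formula → Formula → Formula
  ∼_  : Formula → Formula

∼^ : ℕ → Formula → Formula
∼^ zero    A = A
∼^ (suc n) A = ∼ (∼^ n A)

-- Truth values of 4Q: T top, F bottom, TU and FU incomparable
data U : Set where
  T TU FU F : U

_⊓_ : U → U → U
T  ⊓ y  = y
F  ⊓ y  = F
TU ⊓ T  = TU
TU ⊓ TU = TU
TU ⊓ FU = F
TU ⊓ F  = F
FU ⊓ T  = FU
FU ⊓ TU = F
FU ⊓ FU = FU
FU ⊓ F  = F

_⊔_ : U → U → U
T  ⊔ y  = T
F  ⊔ y  = y
TU ⊔ T  = T
TU ⊔ TU = TU
TU ⊔ FU = T
TU ⊔ F  = TU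
FU ⊔ T  = T
FU ⊔ TU = T
FU ⊔ FU = FU
FU ⊔ F  = FU

f∼ : U → U
f∼ T  = TU
f∼ TU = F
f∼ F  = FU
f∼ FU = T

data Designated : U → Set where
  desT  : Designated T
  desTU : Designated TU

eval : (PV → U) → Formula → U
eval v (var p) = v p
eval v (A ∧ B) = eval v A ⊓ eval v B
eval v (A ∨ B) = eval v A ⊔ eval v B
eval v (∼ A)   = f∼ (eval v A)

_⊨_ : Formula → Formula → Set
A ⊨ B = (v : PV → U) → Designated (eval v A) → Designated (eval v B)

-- provability in the calculus CNL₄² (derivations as trees; equivalent to
-- the existence of a finite proof list ending in A ⊢ B)
infix 4 _⊢_
data _⊢_ : Formula → Formula → Set where
  a1  : ∀ {A B} → A ∧ B ⊢ A
  a2  : ∀ {A B} → A ∧ B ⊢ B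
  a3  : ∀ {A B} → B ⊢ A ∨ B
  a4  : ∀ {A B} → A ⊢ A ∨ B
  a5  : ∀ {A} → A ⊢ ∼^ 4 A
  a6  : ∀ {A} → ∼^ 4 A ⊢ A
  a7  : ∀ {A B} → ∼ A ∧ ∼ B ⊢ ∼ (A ∧ B)
  a8  : ∀ {A B} → ∼ (A ∨ B) ⊢ ∼ A ∨ ∼ B
  a9  : ∀ {A B} → A ∧ ∼^ 2 A ⊢ B
  a10 : ∀ {A B C} → A ∧ (B ∨ C) ⊢ (A ∧ B) ∨ (A ∧ C)
  b1  : ∀ {A B} → ∼ (A ∧ B) ⊢ ∼ A ∧ ∼ B
  b2  : ∀ {A B} → ∼ A ∨ ∼ B ⊢ ∼ (A ∨ B)
  r1  : ∀ {A B C} → A ⊢ B → B ⊢ C → A ⊢ C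
  r2  : ∀ {A B C} → A ⊢ B → A ⊢ C → A ⊢ B ∧ C
  r3  : ∀ {A B C} → A ⊢ C → B ⊢ C → A ∨ B ⊢ C
  r4  : ∀ {A B} → A ⊢ B → ∼^ 2 B ⊢ ∼^ 2 A

module Submission where

-- Kalmár's argument for a four-valued logic. A value u of 4Q is determined by the two bits
-- "u is designated" and "f∼ u is designated", and ∼² is the involutive negation exchanging
-- designated and undesignated values. So for a valuation v a context pins a formula C when it
-- proves C or ∼²C, and ∼C or ∼³C, according to these bits of v(C); by induction on formulas,
-- a context pinning the variables pins every formula. If it also proves A, then v(A) is
-- designated (otherwise it proves A ∧ ∼²A and explodes), hence so is v(B), and it proves B.
-- Finally the pinning hypotheses are discharged one variable at a time by the excluded middle
-- C ∨ ∼²C, applied to the variable and to its negation.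

open import Defs
open import Data.Bool using (Bool; true; false; not) renaming (_∧_ to _&&_; _∨_ to _||_)
open import Data.List using (List; []; _∷_; length)
open import Data.Nat using (ℕ; zero; suc; _+_; _≤_; _<_; s≤s⁻¹; _≟_) renaming (_⊔_ to _⊔ℕ_)
open import Data.Nat.Properties using (m⊔n≤o⇒m≤o; m⊔n≤o⇒n≤o; m≤m⊔n; m≤n⊔m; ≤∧≢⇒<; +-suc; +-identityʳ)
open import Relation.Binary.PropositionalEquality using (_≡_; refl; sym; trans; subst)
open import Relation.Nullary using (yes; no)
open import Function using (_∘_)

∼² : Formula → Formula
∼² = ∼^ 2

⊢-refl : ∀ {A} → A ⊢ A
⊢-refl = r1 a5 a6

excluded-middle : ∀ {D C} → D ⊢ C ∨ ∼² C
excluded-middle {C = C} = r1 a5 (r1 (r4 (r1 (r2 ∼²-to-C ∼²-to-∼²C) a9)) a6)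
  where
  ∼²-to-C : ∼² (C ∨ ∼² C) ⊢ C
  ∼²-to-C = r1 (r4 a3) a6
  ∼²-to-∼²C : ∼² (C ∨ ∼² C) ⊢ ∼² C
  ∼²-to-∼²C = r4 a4

∼²-∨ : ∀ {A B} → ∼² A ∧ ∼² B ⊢ ∼² (A ∨ B)
∼²-∨ = r1 a5 (r4 (r3 (r1 a5 (r4 a1)) (r1 a5 (r4 a2))))

∧-assoc : ∀ {A B C} → (A ∧ B) ∧ C ⊢ A ∧ (B ∧ C)
∧-assoc = r2 (r1 a1 a1) (r2 (r1 a1 a2) a2)

∨-cases : ∀ {D C E Z} → D ⊢ C ∨ E → D ∧ C ⊢ Z → D ∧ E ⊢ Z → D ⊢ Z
∨-cases h k l = r1 (r2 ⊢-refl h) (r1 a10 (r3 k l))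

isDesignated : U → Bool
isDesignated T  = true
isDesignated TU = true
isDesignated FU = false
isDesignated F  = false

isDesignated-⊓ : ∀ a b → isDesignated (a ⊓ b) ≡ isDesignated a && isDesignated b
isDesignated-⊓ T  b  = refl
isDesignated-⊓ F  b  = refl
isDesignated-⊓ TU T  = refl
isDesignated-⊓ TU TU = refl
isDesignated-⊓ TU FU = refl
isDesignated-⊓ TU F  = refl
isDesignated-⊓ FU T  = refl
isDesignated-⊓ FU TU = refl
isDesignated-⊓ FU FU = refl
isDesignated-⊓ FU F  = refl

isDesignated-∼⊓ : ∀ a b → isDesignated (f∼ (a ⊓ b)) ≡ isDesignated (f∼ a) && isDesignated (f∼ b)
isDesignated-∼⊓ T  b  = refl
isDesignated-∼⊓ F  b  = refl
isDesignated-∼⊓ TU T  = refl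
isDesignated-∼⊓ TU TU = refl
isDesignated-∼⊓ TU FU = refl
isDesignated-∼⊓ TU F  = refl
isDesignated-∼⊓ FU T  = refl
isDesignated-∼⊓ FU TU = refl
isDesignated-∼⊓ FU FU = refl
isDesignated-∼⊓ FU F  = refl

isDesignated-⊔ : ∀ a b → isDesignated (a ⊔ b) ≡ isDesignated a || isDesignated b
isDesignated-⊔ T  b  = refl
isDesignated-⊔ F  b  = refl
isDesignated-⊔ TU T  = refl
isDesignated-⊔ TU TU = refl
isDesignated-⊔ TU FU = refl
isDesignated-⊔ TU F  = refl
isDesignated-⊔ FU T  = refl
isDesignated-⊔ FU TU = refl
isDesignated-⊔ FU FU = refl
isDesignated-⊔ FU F  = refl

isDesignated-∼⊔ : ∀ a b → isDesignated (f∼ (a ⊔ b)) ≡ isDesignated (f∼ a) || isDesignated (f∼ b)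
isDesignated-∼⊔ T  b  = refl
isDesignated-∼⊔ F  b  = refl
isDesignated-∼⊔ TU T  = refl
isDesignated-∼⊔ TU TU = refl
isDesignated-∼⊔ TU FU = refl
isDesignated-∼⊔ TU F  = refl
isDesignated-∼⊔ FU T  = refl
isDesignated-∼⊔ FU TU = refl
isDesignated-∼⊔ FU FU = refl
isDesignated-∼⊔ FU F  = refl

isDesignated-∼∼ : ∀ a → isDesignated (f∼ (f∼ a)) ≡ not (isDesignated a)
isDesignated-∼∼ T  = refl
isDesignated-∼∼ TU = refl
isDesignated-∼∼ FU = refl
isDesignated-∼∼ F  = refl

literal : Formula → Bool → Formula
literal A true  = A
literal A false = ∼² A

module _ {G : Formula} where

  literal-∧ : ∀ {A B} x y → G ⊢ literal A x → G ⊢ literal B y → G ⊢ literal (A ∧ B) (x && y)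
  literal-∧ true  true  h k = r2 h k
  literal-∧ true  false h k = r1 k (r4 a2)
  literal-∧ false y     h k = r1 h (r4 a1)

  literal-∼∧ : ∀ {A B} x y → G ⊢ literal (∼ A) x → G ⊢ literal (∼ B) y → G ⊢ literal (∼ (A ∧ B)) (x && y)
  literal-∼∧ true  true  h k = r1 (r2 h k) a7
  literal-∼∧ true  false h k = r1 k (r4 (r1 b1 a2))
  literal-∼∧ false y     h k = r1 h (r4 (r1 b1 a1))

  literal-∨ : ∀ {A B} x y → G ⊢ literal A x → G ⊢ literal B y → G ⊢ literal (A ∨ B) (x || y)
  literal-∨ true  y     h k = r1 h a4
  literal-∨ false true  h k = r1 k a3
  literal-∨ false false h k = r1 (r2 h k) ∼²-∨

  literal-∼∨ : ∀ {A B} x y → G ⊢ literal (∼ A) x → G ⊢ literal (∼ B) y → G ⊢ literal (∼ (A ∨ B)) (x || y)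
  literal-∼∨ true  y     h k = r1 h (r1 a4 b2)
  literal-∼∨ false true  h k = r1 k (r1 a3 b2)
  literal-∼∨ false false h k = r1 (r2 h k) (r1 ∼²-∨ (r4 a8))

  literal-∼∼ : ∀ {A} x → G ⊢ literal A x → G ⊢ literal (∼ (∼ A)) (not x)
  literal-∼∼ true  h = r1 h a5
  literal-∼∼ false h = h

  literal-designated : ∀ {A u} → Designated u → G ⊢ literal A (isDesignated u) → G ⊢ A
  literal-designated desT  h = h
  literal-designated desTU h = h

  literal-explosion : ∀ {A B} u → (Designated u → G ⊢ B) → G ⊢ A → G ⊢ literal A (isDesignated u) → G ⊢ B
  literal-explosion T  k _ _ = k desT
  literal-explosion TU k _ _ = k desTU
  literal-explosion FU _ g h = r1 (r2 g h) a9
  literal-explosion F  _ g h = r1 (r2 g h) a9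

record Pins (G A : Formula) (u : U) : Set where
  constructor _,_
  field
    pins-literal   : G ⊢ literal A (isDesignated u)
    pins-∼-literal : G ⊢ literal (∼ A) (isDesignated (f∼ u))
open Pins

module _ {G : Formula} where

  pins-∧ : ∀ {A B a b} → Pins G A a → Pins G B b → Pins G (A ∧ B) (a ⊓ b)
  pins-∧ {A} {B} {a} {b} (hA , h∼A) (hB , h∼B) =
    subst ((G ⊢_) ∘ literal (A ∧ B)) (sym (isDesignated-⊓ a b))
      (literal-∧ {A = A} {B} (isDesignated a) (isDesignated b) hA hB) ,
    subst ((G ⊢_) ∘ literal (∼ (A ∧ B))) (sym (isDesignated-∼⊓ a b))
      (literal-∼∧ {A = A} {B} (isDesignated (f∼ a)) (isDesignated (f∼ b)) h∼A h∼B)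

  pins-∨ : ∀ {A B a b} → Pins G A a → Pins G B b → Pins G (A ∨ B) (a ⊔ b)
  pins-∨ {A} {B} {a} {b} (hA , h∼A) (hB , h∼B) =
    subst ((G ⊢_) ∘ literal (A ∨ B)) (sym (isDesignated-⊔ a b))
      (literal-∨ {A = A} {B} (isDesignated a) (isDesignated b) hA hB) ,
    subst ((G ⊢_) ∘ literal (∼ (A ∨ B))) (sym (isDesignated-∼⊔ a b))
      (literal-∼∨ {A = A} {B} (isDesignated (f∼ a)) (isDesignated (f∼ b)) h∼A h∼B)

  pins-∼ : ∀ {A a} → Pins G A a → Pins G (∼ A) (f∼ a)
  pins-∼ {A} {a} (hA , h∼A) =
    h∼A ,
    subst ((G ⊢_) ∘ literal (∼ (∼ A))) (sym (isDesignated-∼∼ a))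
      (literal-∼∼ {A = A} (isDesignated a) hA)

bound : Formula → ℕ
bound (var p) = suc p
bound (A ∧ B) = bound A ⊔ℕ bound B
bound (A ∨ B) = bound A ⊔ℕ bound B
bound (∼ A)   = bound A

kalmar : ∀ {G n} v A → bound A ≤ n → (∀ p → p < n → Pins G (var p) (v p)) → Pins G A (eval v A)
kalmar v (var p) p<n pins = pins p p<n
kalmar v (A ∧ B) bnd pins =
  pins-∧ (kalmar v A (m⊔n≤o⇒m≤o _ _ bnd) pins) (kalmar v B (m⊔n≤o⇒n≤o _ _ bnd) pins)
kalmar v (A ∨ B) bnd pins =
  pins-∨ (kalmar v A (m⊔n≤o⇒m≤o _ _ bnd) pins) (kalmar v B (m⊔n≤o⇒n≤o _ _ bnd) pins)
kalmar v (∼ A) bnd pins = pins-∼ (kalmar v A bnd pins)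

⊨⇒⊢-pinned : ∀ {A B G} → A ⊨ B → ∀ v → G ⊢ A →
             (∀ p → p < bound A ⊔ℕ bound B → Pins G (var p) (v p)) → G ⊢ B
⊨⇒⊢-pinned {A} {B} A⊨B v G⊢A pins =
  literal-explosion (eval v A)
    (λ d → literal-designated (A⊨B v d) (pins-literal (kalmar v B (m≤n⊔m _ _) pins)))
    G⊢A (pins-literal (kalmar v A (m≤m⊔n _ _) pins))

χ : Formula → U → Formula
χ A u = literal A (isDesignated u) ∧ literal (∼ A) (isDesignated (f∼ u))

-- The four values realise the four combinations of a literal for A and one for ∼ A.
split : ∀ {D Z} A → (∀ u → D ∧ χ A u ⊢ Z) → D ⊢ Z
split A h =
  ∨-cases excluded-middle
    (∨-cases excluded-middle (r1 ∧-assoc (h T))  (r1 ∧-assoc (h TU)))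
    (∨-cases excluded-middle (r1 ∧-assoc (h FU)) (r1 ∧-assoc (h F)))

-- The head of the list is the value of the variable numbered by the length of its tail;
-- variables beyond the list get the junk value T.
assign : List U → PV → U
assign []       p = T
assign (u ∷ us) p with p ≟ length us
... | yes _ = u
... | no  _ = assign us p

context : Formula → List U → Formula
context D []       = D
context D (u ∷ us) = context D us ∧ χ (var (length us)) u

context-⊢ : ∀ {D} us → context D us ⊢ D
context-⊢ []       = ⊢-refl
context-⊢ (u ∷ us) = r1 a1 (context-⊢ us)

context-pins : ∀ {D} us p → p < length us → Pins (context D us) (var p) (assign us p)
context-pins (u ∷ us) p p<n with p ≟ length us
... | yes refl = r1 a2 a1 , r1 a2 a2
... | no p≢n with context-pins us p (≤∧≢⇒< (s≤s⁻¹ p<n) p≢n)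
...   | h , h∼ = r1 a1 h , r1 a1 h∼

eliminate : ∀ {D Z} n → (∀ us → length us ≡ n → context D us ⊢ Z) → D ⊢ Z
eliminate {D} {Z} n h = go n [] (+-identityʳ n)
  where
  go : ∀ m us → m + length us ≡ n → context D us ⊢ Z
  go zero    us eq = h us eq
  go (suc m) us eq = split (var (length us)) λ u → go m (u ∷ us) (trans (+-suc m (length us)) eq)

mainTheorem9 : (A B : Formula) → A ⊨ B → A ⊢ B
mainTheorem9 A B A⊨B = eliminate (bound A ⊔ℕ bound B) λ us len →
  ⊨⇒⊢-pinned A⊨B (assign us) (context-⊢ us)
    λ p p<n → context-pins us p (subst (p <_) (sym len) p<n)
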